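{- For every even integer $n>4$, $\beta_{[\pm1]}(n,n-2)=3$.
   Context: For a positive integer $n$, $[n]=\{1,\dots,n\}$ and $\binom{[n]}{k}$ is the family of all $k$-element subsets of $[n]$. For a set $D$ of integers and families $\mathcal{F},\mathcal{F}'$ of subsets of $[n]$, $\mathcal{F}'$ is called $D$-secting for $\mathcal{F}$ if for every $A\in\mathcal{F}$ there exists $A'\in\mathcal{F}'$ with $|A\cap A'|-|A\cap([n]\setminus A')|\in D$. $\beta_D(\mathcal{F})$ is the minimum cardinality of a $D$-secting family for $\mathcal{F}$; $\beta_{[\pm 1]}$ denotes $\beta_D$ with $D=\{ -1,0,1\}$. $\beta_{[\pm1]}(n,k)$ is the maximum of $\beta_{[\pm1]}(\mathcal{F})$ over all families $\mathcal{F}\subseteq\binom{[n]}{k}$. -}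

module Defs where

open import Data.Nat using (ℕ; _≤_)
open import Data.Integer as ℤ using (ℤ; +_; -[1+_])
open import Data.Fin.Subset using (Subset; _∩_; ∁; ∣_∣)
open import Data.List using (List; length)
open import Data.List.Relation.Unary.All using (All)
open import Data.List.Relation.Unary.Any using (Any)
open import Data.Product using (Σ; _×_)
open import Data.Sum using (_⊎_)
open import Relation.Binary.PropositionalEquality using (_≡_)

disc : ∀ {n} → Subset n → Subset n → ℤ
disc A A' = (+ ∣ A ∩ A' ∣) ℤ.- (+ ∣ A ∩ ∁ A' ∣)

D±1 : ℤ → Set
D±1 d = (d ≡ -[1+ 0 ]) ⊎ (d ≡ + 0) ⊎ (d ≡ + 1)

Secting : ∀ {n} → (ℤ → Set) → List (Subset n) → List (Subset n) → Set
Secting D F F' = All (λ A → Any (λ A' → D (disc A A')) F') F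

Uniform : ∀ {n} → ℕ → List (Subset n) → Set
Uniform k F = All (λ A → ∣ A ∣ ≡ k) F

βLe : ∀ {n} → (ℤ → Set) → List (Subset n) → ℕ → Set
βLe D F m = Σ (List _) (λ F' → (length F' ≤ m) × Secting D F F')

βGe : ∀ {n} → (ℤ → Set) → List (Subset n) → ℕ → Set
βGe D F m = ∀ F' → Secting D F F' → m ≤ length F'

-- Since |A| = 2k is even, disc A X ∈ {-1, 0, 1} forces |A ∩ X| = k.  Put n = 2k + 2.
--
-- Upper bound: with H a k-subset of the last 2k points, let X₀ = H, X₁ = H plus the
-- second point and X₂ = X₁ plus the first point.  For |A| = 2k we have
-- |A ∩ X₀| ≤ k ≤ |A ∩ X₂| (as |A ∖ X₂| ≤ |∁ X₂| = k), and the three counts grow in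
-- unit steps, so one of them equals k.
--
-- Lower bound: take all complements of pairs.  X halves [n] ∖ {i, j} iff
-- |X| = x_i + x_j + k, so the pairs halved by X form a clique (|X| = k or k + 2),
-- the complete bipartite graph between X and ∁ X (|X| = k + 1), or nothing.  If X
-- and Y together halve all of them, then |X| = k + 1: otherwise some vertex v is
-- isolated for X, so Y halves every pair through v, which forces Y to be constant
-- off v and, as k ≥ 2, contradicts |Y| = y_v + y_u + k.  Likewise |Y| = k + 1; but
-- as n > 4 two points agree on both X and Y, and then neither halves that pair.
module Submission where

open import Defs
open import Data.Nat using (ℕ; _<_; _∸_)
open import Data.Nat.Divisibility using (_∣_)
open import Data.Fin.Subset using (Subset)
open import Data.List using (List)
open import Data.Product using (Σ; _×_)

open import Data.Bool.Base using (Bool; true; false; not; _∧_)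
open import Data.Bool.Properties using (∧-identityʳ; ∧-zeroʳ; not-injective)
open import Data.Empty using (⊥-elim)
open import Data.Fin.Base using (Fin; zero; suc; punchIn; combine)
open import Data.Fin.Properties as Fin using (2↔Bool; pigeonhole; punchInᵢ≢i; combine-injectiveˡ; combine-injectiveʳ)
open import Data.Fin.Subset using (_∈_; _∩_; ∁; _-_; _─_; ⁅_⁆; ⊤; ⊥; ∣_∣; Empty; _⊆_; inside; outside)
open import Data.Fin.Subset.Properties using (∣p∣≤n; ∣∁p∣≡n∸∣p∣; ∣⊤∣≡n; ∣⊥∣≡0; ∣⁅x⁆∣≡1; ∈⊤; x∈⁅x⁆; x∈p∧x≢y⇒x∈p-y; p─⊥≡p; p⊆q⇒∣p∣≤∣q∣; ∣p∩q∣≤∣q∣; Empty-unique; nonempty?; ∩-identityˡ; ∩-identityʳ)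
open import Data.Integer.Base as ℤ using (_⊖_)
open import Data.Integer.Properties using ([+m]-[+n]≡m⊖n; [1+m]⊖[1+n]≡m⊖n; n⊖n≡0)
open import Data.List.Base as List using ([]; _∷_; filter; cartesianProductWith; allFin)
open import Data.List.Membership.Propositional using () renaming (_∈_ to _∈ₗ_)
open import Data.List.Membership.Propositional.Properties using (∈-filter⁺; ∈-cartesianProductWith⁺; ∈-allFin)
import Data.List.Relation.Unary.All as All
open import Data.List.Relation.Unary.All.Properties using (all-filter)
open import Data.List.Relation.Unary.Any as Any using (Any; here; there)
open import Data.List.Relation.Unary.Any.Properties using (singleton⁻)
open import Data.Nat.Base using (zero; suc; _+_; _≤_; z≤n; s≤s; ⌊_/2⌋; ⌈_/2⌉)
open import Data.Nat.Divisibility using (divides)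
open import Data.Nat.Properties
open import Data.Product using (∃; ∃₂; _,_; proj₁; proj₂)
open import Data.Sum as Sum using (_⊎_; inj₁; inj₂; [_,_]′)
open import Data.Vec.Base as Vec using ([]; _∷_; _++_; lookup)
open import Data.Vec.Properties using ([]=⇒lookup; lookup-map)
open import Function.Base using (_∘_; id)
open import Function.Bundles using (Inverse; Equivalence; _⇔_; mk⇔)
open import Relation.Nullary using (¬_; yes; no; contradiction)
open import Relation.Binary.Definitions using (tri<; tri≈; tri>)
open import Relation.Binary.PropositionalEquality
open import Algebra.Properties.CommutativeSemigroup +-commutativeSemigroup using (x∙yz≈y∙xz)

private
  variable
    n k : ℕ

𝟙 : Bool → ℕ
𝟙 true  = 1
𝟙 false = 0

𝟙≤1 : ∀ b → 𝟙 b ≤ 1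
𝟙≤1 true  = ≤-refl
𝟙≤1 false = z≤n

𝟙-injective : ∀ {a b} → 𝟙 a ≡ 𝟙 b → a ≡ b
𝟙-injective {true}  {true}  _ = refl
𝟙-injective {false} {false} _ = refl

∣x∷p∣≡𝟙x+∣p∣ : ∀ x (p : Subset n) → ∣ x ∷ p ∣ ≡ 𝟙 x + ∣ p ∣
∣x∷p∣≡𝟙x+∣p∣ true  p = refl
∣x∷p∣≡𝟙x+∣p∣ false p = refl

∣p∩q∣+∣p∩∁q∣≡∣p∣ : ∀ (p q : Subset n) → ∣ p ∩ q ∣ + ∣ p ∩ ∁ q ∣ ≡ ∣ p ∣
∣p∩q∣+∣p∩∁q∣≡∣p∣ []            []            = refl
∣p∩q∣+∣p∩∁q∣≡∣p∣ (true  ∷ p) (true  ∷ q) = cong suc (∣p∩q∣+∣p∩∁q∣≡∣p∣ p q)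
∣p∩q∣+∣p∩∁q∣≡∣p∣ (true  ∷ p) (false ∷ q) = trans (+-suc _ _) (cong suc (∣p∩q∣+∣p∩∁q∣≡∣p∣ p q))
∣p∩q∣+∣p∩∁q∣≡∣p∣ (false ∷ p) (_     ∷ q) = ∣p∩q∣+∣p∩∁q∣≡∣p∣ p q

Empty⇒∣p∣≡0 : ∀ {p : Subset n} → Empty p → ∣ p ∣ ≡ 0
Empty⇒∣p∣≡0 {n} p-empty = trans (cong ∣_∣ (Empty-unique p-empty)) (∣⊥∣≡0 n)

∣p∣+∣∁p∣≡n : ∀ (p : Subset n) → ∣ p ∣ + ∣ ∁ p ∣ ≡ n
∣p∣+∣∁p∣≡n p = trans (cong (∣ p ∣ +_) (∣∁p∣≡n∸∣p∣ p)) (m+[n∸m]≡n (∣p∣≤n p))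

x∈p⇒∣p∩q∣≡𝟙+∣[p-x]∩q∣ : ∀ {p : Subset n} {x} → x ∈ p → ∀ q →
                        ∣ p ∩ q ∣ ≡ 𝟙 (lookup q x) + ∣ (p - x) ∩ q ∣
x∈p⇒∣p∩q∣≡𝟙+∣[p-x]∩q∣ {p = _ ∷ p} Vec.here (t ∷ q) = begin
  ∣ t ∷ p ∩ q ∣            ≡⟨ ∣x∷p∣≡𝟙x+∣p∣ t (p ∩ q) ⟩
  𝟙 t + ∣ p ∩ q ∣          ≡⟨ cong (λ r → 𝟙 t + ∣ r ∩ q ∣) (p─⊥≡p p) ⟨
  𝟙 t + ∣ (p ─ ⊥) ∩ q ∣     ∎
  where open ≡-Reasoning
x∈p⇒∣p∩q∣≡𝟙+∣[p-x]∩q∣ {p = s ∷ p} {suc x} (Vec.there x∈p) (t ∷ q) = begin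
  ∣ (s ∧ t) ∷ p ∩ q ∣                          ≡⟨ ∣x∷p∣≡𝟙x+∣p∣ (s ∧ t) (p ∩ q) ⟩
  𝟙 (s ∧ t) + ∣ p ∩ q ∣                        ≡⟨ cong (𝟙 (s ∧ t) +_) (x∈p⇒∣p∩q∣≡𝟙+∣[p-x]∩q∣ x∈p q) ⟩
  𝟙 (s ∧ t) + (𝟙 (lookup q x) + ∣ (p - x) ∩ q ∣) ≡⟨ x∙yz≈y∙xz (𝟙 (s ∧ t)) (𝟙 (lookup q x)) _ ⟩
  𝟙 (lookup q x) + (𝟙 (s ∧ t) + ∣ (p - x) ∩ q ∣) ≡⟨ cong (𝟙 (lookup q x) +_) (∣x∷p∣≡𝟙x+∣p∣ (s ∧ t) ((p - x) ∩ q)) ⟨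
  𝟙 (lookup q x) + ∣ (s ∧ t) ∷ (p - x) ∩ q ∣     ∎
  where open ≡-Reasoning

m+m≡n+n⇒m≡n : ∀ {m n} → m + m ≡ n + n → m ≡ n
m+m≡n+n⇒m≡n {m} {n} e = trans (n≡⌊n+n/2⌋ m) (trans (cong ⌊_/2⌋ e) (sym (n≡⌊n+n/2⌋ n)))

-- Halving m + m = suc (n + n) rounded down gives m ≡ n, rounded up m ≡ suc n.
m+m≢1+n+n : ∀ m n → m + m ≢ suc (n + n)
m+m≢1+n+n m n e = 1+n≢n (trans (sym m≡1+n) m≡n)
  where
  m≡n : m ≡ n
  m≡n = trans (n≡⌊n+n/2⌋ m) (trans (cong ⌊_/2⌋ e) (sym (n≡⌈n+n/2⌉ n)))
  m≡1+n : m ≡ suc n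
  m≡1+n = trans (n≡⌈n+n/2⌉ m) (trans (cong ⌈_/2⌉ e) (cong suc (sym (n≡⌊n+n/2⌋ n))))

⊖∈D±1⇒ : ∀ a b → D±1 (a ⊖ b) → b ≡ suc a ⊎ a ≡ b ⊎ a ≡ suc b
⊖∈D±1⇒ zero          zero          _                = inj₂ (inj₁ refl)
⊖∈D±1⇒ zero          (suc zero)    _                = inj₁ refl
⊖∈D±1⇒ zero          (suc (suc b)) (inj₁ ())
⊖∈D±1⇒ zero          (suc (suc b)) (inj₂ (inj₁ ()))
⊖∈D±1⇒ zero          (suc (suc b)) (inj₂ (inj₂ ()))
⊖∈D±1⇒ (suc zero)    zero          _                = inj₂ (inj₂ refl)
⊖∈D±1⇒ (suc (suc a)) zero          (inj₁ ())
⊖∈D±1⇒ (suc (suc a)) zero          (inj₂ (inj₁ ()))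
⊖∈D±1⇒ (suc (suc a)) zero          (inj₂ (inj₂ ()))
⊖∈D±1⇒ (suc a)       (suc b)       d                =
  Sum.map (cong suc) (Sum.map (cong suc) (cong suc))
          (⊖∈D±1⇒ a b (subst D±1 ([1+m]⊖[1+n]≡m⊖n a b) d))

D±1[disc]⇔∣∩∣≡k : ∀ {A X : Subset n} → ∣ A ∣ ≡ k + k → D±1 (disc A X) ⇔ ∣ A ∩ X ∣ ≡ k
D±1[disc]⇔∣∩∣≡k {k = k} {A} {X} size = mk⇔ ⇒half half⇒
  where
  a = ∣ A ∩ X ∣
  b = ∣ A ∩ ∁ X ∣
  a+b≡k+k : a + b ≡ k + k
  a+b≡k+k = trans (∣p∩q∣+∣p∩∁q∣≡∣p∣ A X) size
  ⇒half : D±1 (disc A X) → a ≡ k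
  ⇒half d with ⊖∈D±1⇒ a b (subst D±1 ([+m]-[+n]≡m⊖n a b) d)
  ... | inj₁ b≡1+a = contradiction (trans (sym a+b≡k+k) (trans (cong (a +_) b≡1+a) (+-suc a a))) (m+m≢1+n+n k a)
  ... | inj₂ (inj₁ a≡b) = m+m≡n+n⇒m≡n (trans (cong (a +_) a≡b) a+b≡k+k)
  ... | inj₂ (inj₂ a≡1+b) = contradiction (trans (sym a+b≡k+k) (cong (_+ b) a≡1+b)) (m+m≢1+n+n k b)
  half⇒ : a ≡ k → D±1 (disc A X)
  half⇒ a≡k = inj₂ (inj₁ (begin
    disc A X  ≡⟨ [+m]-[+n]≡m⊖n a b ⟩
    a ⊖ b     ≡⟨ cong₂ _⊖_ a≡k b≡k ⟩
    k ⊖ k     ≡⟨ n⊖n≡0 k ⟩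
    ℤ.+ 0     ∎))
    where
    open ≡-Reasoning
    b≡k : b ≡ k
    b≡k = +-cancelˡ-≡ k b k (trans (cong (_+ b) (sym a≡k)) a+b≡k+k)

unit-steps-hit : ∀ {c₀ c₁ c₂ k} → c₀ ≤ k → k ≤ c₂ → c₁ ≤ suc c₀ → c₂ ≤ suc c₁ →
                 k ≡ c₀ ⊎ k ≡ c₁ ⊎ k ≡ c₂
unit-steps-hit c₀≤k k≤c₂ c₁≤1+c₀ c₂≤1+c₁ with m≤n⇒m<n∨m≡n k≤c₂
... | inj₂ k≡c₂ = inj₂ (inj₂ k≡c₂)
... | inj₁ k<c₂ with m≤n⇒m<n∨m≡n (≤-pred (≤-trans k<c₂ c₂≤1+c₁))
...   | inj₂ k≡c₁ = inj₂ (inj₁ k≡c₁)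
...   | inj₁ k<c₁ = inj₁ (≤-antisym (≤-pred (≤-trans k<c₁ c₁≤1+c₀)) c₀≤k)

∣⊤++⊥∣≡m : ∀ m n → ∣ ⊤ {m} ++ ⊥ {n} ∣ ≡ m
∣⊤++⊥∣≡m zero    n = ∣⊥∣≡0 n
∣⊤++⊥∣≡m (suc m) n = cong suc (∣⊤++⊥∣≡m m n)

∣∷∷∩∷∷∣ : ∀ a b s t (A B : Subset n) → ∣ (a ∷ b ∷ A) ∩ (s ∷ t ∷ B) ∣ ≡ 𝟙 (a ∧ s) + (𝟙 (b ∧ t) + ∣ A ∩ B ∣)
∣∷∷∩∷∷∣ a b s t A B = trans (∣x∷p∣≡𝟙x+∣p∣ (a ∧ s) ((b ∧ t) ∷ A ∩ B)) (cong (𝟙 (a ∧ s) +_) (∣x∷p∣≡𝟙x+∣p∣ (b ∧ t) (A ∩ B)))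

module ThreeSets (k : ℕ) where

  H : Subset (k + k)
  H = ⊤ {k} ++ ⊥ {k}

  X₀ X₁ X₂ : Subset (2 + (k + k))
  X₀ = outside ∷ outside ∷ H
  X₁ = outside ∷ inside  ∷ H
  X₂ = inside  ∷ inside  ∷ H

  sects : ∀ A → ∣ A ∣ ≡ k + k → Any (λ X → D±1 (disc A X)) (X₀ ∷ X₁ ∷ X₂ ∷ [])
  sects A′@(a ∷ b ∷ A) size =
    [ here ∘ halves e₀ , [ there ∘ here ∘ halves e₁ , there ∘ there ∘ here ∘ halves e₂ ]′ ]′
      (unit-steps-hit p≤k k≤c₂ (+-monoˡ-≤ p (𝟙≤1 b)) (+-monoˡ-≤ (𝟙 b + p) (𝟙≤1 a)))
    where
    p = ∣ A ∩ H ∣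
    halves : ∀ {X c} → ∣ A′ ∩ X ∣ ≡ c → k ≡ c → D±1 (disc A′ X)
    halves {X} e k≡c = Equivalence.from (D±1[disc]⇔∣∩∣≡k {A = A′} {X} size) (trans e (sym k≡c))
    e₀ : ∣ A′ ∩ X₀ ∣ ≡ p
    e₀ = trans (∣∷∷∩∷∷∣ a b false false A H) (cong₂ (λ x y → 𝟙 x + (𝟙 y + p)) (∧-zeroʳ a) (∧-zeroʳ b))
    e₁ : ∣ A′ ∩ X₁ ∣ ≡ 𝟙 b + p
    e₁ = trans (∣∷∷∩∷∷∣ a b false true A H) (cong₂ (λ x y → 𝟙 x + (𝟙 y + p)) (∧-zeroʳ a) (∧-identityʳ b))
    e₂ : ∣ A′ ∩ X₂ ∣ ≡ 𝟙 a + (𝟙 b + p)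
    e₂ = trans (∣∷∷∩∷∷∣ a b true true A H) (cong₂ (λ x y → 𝟙 x + (𝟙 y + p)) (∧-identityʳ a) (∧-identityʳ b))
    p≤k : p ≤ k
    p≤k = ≤-trans (∣p∩q∣≤∣q∣ A H) (≤-reflexive (∣⊤++⊥∣≡m k k))
    ∣∁H∣≡k : ∣ ∁ H ∣ ≡ k
    ∣∁H∣≡k = trans (∣∁p∣≡n∸∣p∣ H) (trans (cong (k + k ∸_) (∣⊤++⊥∣≡m k k)) (m+n∸n≡m k k))
    k≤c₂ : k ≤ 𝟙 a + (𝟙 b + p)
    k≤c₂ = subst (k ≤_) e₂ (+-cancelʳ-≤ k k _ (begin
      k + k                       ≡⟨ trans (∣p∩q∣+∣p∩∁q∣≡∣p∣ A′ X₂) size ⟨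
      ∣ A′ ∩ X₂ ∣ + ∣ A′ ∩ ∁ X₂ ∣   ≤⟨ +-monoʳ-≤ ∣ A′ ∩ X₂ ∣ (≤-trans (∣p∩q∣≤∣q∣ A′ (∁ X₂)) (≤-reflexive ∣∁H∣≡k)) ⟩
      ∣ A′ ∩ X₂ ∣ + k               ∎))
      where open ≤-Reasoning

  β≤3 : ∀ F → Uniform (k + k) F → βLe D±1 F 3
  β≤3 F uniform = X₀ ∷ X₁ ∷ X₂ ∷ [] , ≤-refl , All.map (λ {A} → sects A) uniform

pairComplement : Fin n → Fin n → Subset n
pairComplement i j = ⊤ - i - j

∣q∣≡𝟙+𝟙+∣pairComplement∩q∣ : ∀ {i j : Fin n} → i ≢ j → ∀ q →
  ∣ q ∣ ≡ 𝟙 (lookup q i) + (𝟙 (lookup q j) + ∣ pairComplement i j ∩ q ∣)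
∣q∣≡𝟙+𝟙+∣pairComplement∩q∣ {i = i} {j} i≢j q = begin
  ∣ q ∣                                              ≡⟨ cong ∣_∣ (∩-identityˡ q) ⟨
  ∣ ⊤ ∩ q ∣                                          ≡⟨ x∈p⇒∣p∩q∣≡𝟙+∣[p-x]∩q∣ ∈⊤ q ⟩
  𝟙 (lookup q i) + ∣ (⊤ - i) ∩ q ∣                   ≡⟨ cong (𝟙 (lookup q i) +_) (x∈p⇒∣p∩q∣≡𝟙+∣[p-x]∩q∣ j∈⊤-i q) ⟩
  𝟙 (lookup q i) + (𝟙 (lookup q j) + ∣ pairComplement i j ∩ q ∣) ∎
  where
  open ≡-Reasoning
  j∈⊤-i : j ∈ ⊤ - i
  j∈⊤-i = x∈p∧x≢y⇒x∈p-y ∈⊤ (≢-sym i≢j)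

∣pairComplement∣≡n∸2 : ∀ {i j : Fin n} → i ≢ j → ∣ pairComplement i j ∣ ≡ n ∸ 2
∣pairComplement∣≡n∸2 {n} {i} {j} i≢j = cong (_∸ 2) (begin
  2 + ∣ pairComplement i j ∣
    ≡⟨ cong₂ (λ x y → 𝟙 x + (𝟙 y + ∣ pairComplement i j ∣)) (lookup-⊤ i) (lookup-⊤ j) ⟨
  𝟙 (lookup ⊤ i) + (𝟙 (lookup ⊤ j) + ∣ pairComplement i j ∣)
    ≡⟨ cong (λ p → 𝟙 (lookup ⊤ i) + (𝟙 (lookup ⊤ j) + ∣ p ∣)) (∩-identityʳ (pairComplement i j)) ⟨
  𝟙 (lookup ⊤ i) + (𝟙 (lookup ⊤ j) + ∣ pairComplement i j ∩ ⊤ ∣)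
    ≡⟨ ∣q∣≡𝟙+𝟙+∣pairComplement∩q∣ i≢j ⊤ ⟨
  ∣ ⊤ {n} ∣
    ≡⟨ ∣⊤∣≡n n ⟩
  n ∎)
  where
  open ≡-Reasoning
  lookup-⊤ : ∀ x → lookup (⊤ {n}) x ≡ true
  lookup-⊤ x = []=⇒lookup (∈⊤ {x = x})

-- all of binom([n], n - 2), each member listed twice
pairComplements : ∀ n → List (Subset n)
pairComplements n = filter (λ A → ∣ A ∣ ≟ n ∸ 2) (cartesianProductWith pairComplement (allFin n) (allFin n))

pairComplement∈pairComplements : ∀ {i j : Fin n} → i ≢ j → pairComplement i j ∈ₗ pairComplements n
pairComplement∈pairComplements {n} i≢j =
  ∈-filter⁺ (λ A → ∣ A ∣ ≟ n ∸ 2) (∈-cartesianProductWith⁺ pairComplement (∈-allFin _) (∈-allFin _)) (∣pairComplement∣≡n∸2 i≢j)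

pairComplements-uniform : Uniform (n ∸ 2) (pairComplements n)
pairComplements-uniform {n} = all-filter (λ A → ∣ A ∣ ≟ n ∸ 2) (cartesianProductWith pairComplement (allFin n) (allFin n))

-- X halves [n] ∖ {i, j}, by ∣q∣≡𝟙+𝟙+∣pairComplement∩q∣.
Halves : ℕ → Subset n → Fin n → Fin n → Set
Halves k X i j = ∣ X ∣ ≡ 𝟙 (lookup X i) + (𝟙 (lookup X j) + k)

D±1[disc]⇒Halves : ∀ {i j : Fin (2 + (k + k))} → i ≢ j → ∀ X →
                   D±1 (disc (pairComplement i j) X) → Halves k X i j
D±1[disc]⇒Halves {i = i} {j} i≢j X d =
  trans (∣q∣≡𝟙+𝟙+∣pairComplement∩q∣ i≢j X)
        (cong (λ m → 𝟙 (lookup X i) + (𝟙 (lookup X j) + m))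
              (Equivalence.to (D±1[disc]⇔∣∩∣≡k {A = pairComplement i j} {X} (∣pairComplement∣≡n∸2 i≢j)) d))

Halves-bounds : ∀ (X : Subset n) {v u} → Halves k X v u →
                𝟙 (lookup X v) + k ≤ ∣ X ∣ × ∣ X ∣ ≤ 𝟙 (lookup X v) + suc k
Halves-bounds {k = k} X {v} {u} h =
    ≤-trans (+-monoʳ-≤ (𝟙 (lookup X v)) (m≤n+m k _)) (≤-reflexive (sym h))
  , ≤-trans (≤-reflexive h) (+-monoʳ-≤ (𝟙 (lookup X v)) (+-monoˡ-≤ k (𝟙≤1 (lookup X u))))

Halves⇒k≤∣X∣≤2+k : ∀ (X : Subset n) {v u} → Halves k X v u → k ≤ ∣ X ∣ × ∣ X ∣ ≤ 2 + k
Halves⇒k≤∣X∣≤2+k {k = k} X {v} h =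
    ≤-trans (m≤n+m k _) (proj₁ (Halves-bounds X h))
  , ≤-trans (proj₂ (Halves-bounds X h)) (+-monoˡ-≤ (suc k) (𝟙≤1 (lookup X v)))

Halves⇒lookup≢ : ∀ (X : Subset n) {i j} → ∣ X ∣ ≡ suc k → Halves k X i j → lookup X i ≢ lookup X j
Halves⇒lookup≢ {k = k} X {i} {j} ∣X∣≡1+k h xᵢ≡xⱼ =
  1+k≢𝟙b+[𝟙b+k] (lookup X j) (trans (sym ∣X∣≡1+k) (trans h (cong (λ b → 𝟙 b + (𝟙 (lookup X j) + k)) xᵢ≡xⱼ)))
  where
  1+k≢𝟙b+[𝟙b+k] : ∀ b → suc k ≢ 𝟙 b + (𝟙 b + k)
  1+k≢𝟙b+[𝟙b+k] false = 1+n≢n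
  1+k≢𝟙b+[𝟙b+k] true  = 1+n≢n ∘ sym ∘ suc-injective

Isolated : ℕ → Subset n → Fin n → Set
Isolated k X v = ∀ u → ¬ Halves k X v u

∣X∣≤k⇒∃-Isolated : 1 ≤ k → ∀ (X : Subset (suc n)) → ∣ X ∣ ≤ k → ∃ (Isolated k X)
∣X∣≤k⇒∃-Isolated {k} 1≤k X ∣X∣≤k with nonempty? X
... | yes (v , v∈X) = v , λ u h →
  ≤⇒≯ ∣X∣≤k (subst (λ b → 𝟙 b + k ≤ ∣ X ∣) ([]=⇒lookup v∈X) (proj₁ (Halves-bounds X h)))
... | no X-empty = zero , λ u h →
  ≤⇒≯ (subst (k ≤_) (Empty⇒∣p∣≡0 X-empty) (proj₁ (Halves⇒k≤∣X∣≤2+k X h))) 1≤k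

1+k<∣X∣⇒∃-Isolated : 1 ≤ k → ∀ (X : Subset (2 + (k + k))) → suc k < ∣ X ∣ → ∃ (Isolated k X)
1+k<∣X∣⇒∃-Isolated {k} 1≤k X 1+k<∣X∣ with nonempty? (∁ X)
... | yes (v , v∈∁X) = v , λ u h →
  <⇒≱ 1+k<∣X∣ (subst (λ b → ∣ X ∣ ≤ 𝟙 b + suc k) v∉X (proj₂ (Halves-bounds X h)))
  where
  v∉X : lookup X v ≡ false
  v∉X = not-injective (trans (sym (lookup-map v not X)) ([]=⇒lookup v∈∁X))
... | no ∁X-empty = zero , λ u h →
  <⇒≱ (+-monoʳ-< 2 (m<m+n k 1≤k)) (subst (_≤ 2 + k) ∣X∣≡2+[k+k] (proj₂ (Halves⇒k≤∣X∣≤2+k X h)))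
  where
  ∣X∣≡2+[k+k] : ∣ X ∣ ≡ 2 + (k + k)
  ∣X∣≡2+[k+k] = trans (sym (+-identityʳ ∣ X ∣))
                      (trans (cong (∣ X ∣ +_) (sym (Empty⇒∣p∣≡0 ∁X-empty))) (∣p∣+∣∁p∣≡n X))

lookup≡false-except⇒∣p∣≤1 : ∀ (p : Subset n) x → (∀ y → y ≢ x → lookup p y ≡ false) → ∣ p ∣ ≤ 1
lookup≡false-except⇒∣p∣≤1 p x outside-x =
  ≤-trans (p⊆q⇒∣p∣≤∣q∣ p⊆⁅x⁆) (≤-reflexive (∣⁅x⁆∣≡1 x))
  where
  p⊆⁅x⁆ : p ⊆ ⁅ x ⁆
  p⊆⁅x⁆ {y} y∈p with y Fin.≟ x
  ... | yes refl = x∈⁅x⁆ x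
  ... | no y≢x   = contradiction (trans (sym ([]=⇒lookup y∈p)) (outside-x y y≢x)) λ ()

-- A set halving every pair through v is constant away from v, so it or its
-- complement has at most one element.
¬Halves-star : 2 ≤ k → ∀ (Z : Subset (2 + (k + k))) v → ¬ (∀ u → u ≢ v → Halves k Z v u)
¬Halves-star {k} 2≤k Z v halves = ≤⇒≯ k≤1 2≤k
  where
  u₀ = punchIn v zero
  u₀≢v = punchInᵢ≢i v zero
  k≤∣Z∣≤2+k = Halves⇒k≤∣X∣≤2+k Z (halves u₀ u₀≢v)
  constant : ∀ u → u ≢ v → lookup Z u ≡ lookup Z u₀
  constant u u≢v = 𝟙-injective (+-cancelʳ-≡ k _ _ (+-cancelˡ-≡ (𝟙 (lookup Z v)) _ _
                     (trans (sym (halves u u≢v)) (halves u₀ u₀≢v))))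
  k≤1 : k ≤ 1
  k≤1 with lookup Z u₀ in z₀
  ... | false = ≤-trans (proj₁ k≤∣Z∣≤2+k)
                        (lookup≡false-except⇒∣p∣≤1 Z v λ u u≢v → trans (constant u u≢v) z₀)
  ... | true  = +-cancelˡ-≤ k _ _ (+-cancelˡ-≤ 2 _ _ (begin
    2 + (k + k)       ≡⟨ ∣p∣+∣∁p∣≡n Z ⟨
    ∣ Z ∣ + ∣ ∁ Z ∣     ≤⟨ +-mono-≤ (proj₂ k≤∣Z∣≤2+k) ∣∁Z∣≤1 ⟩
    2 + (k + 1)       ∎))
    where
    open ≤-Reasoning
    ∣∁Z∣≤1 : ∣ ∁ Z ∣ ≤ 1
    ∣∁Z∣≤1 = lookup≡false-except⇒∣p∣≤1 (∁ Z) v λ u u≢v →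
      trans (lookup-map u not Z) (cong not (trans (constant u u≢v) z₀))

PairCover : ℕ → Subset n → Subset n → Set
PairCover k X Y = ∀ i j → i ≢ j → Halves k X i j ⊎ Halves k Y i j

PairCover-swap : ∀ (X Y : Subset n) → PairCover k X Y → PairCover k Y X
PairCover-swap X Y cover i j i≢j = Sum.swap (cover i j i≢j)

PairCover⇒¬Isolated : 2 ≤ k → ∀ (X Y : Subset (2 + (k + k))) → PairCover k X Y → ¬ ∃ (Isolated k X)
PairCover⇒¬Isolated 2≤k X Y cover (v , isolated) = ¬Halves-star 2≤k Y v λ u u≢v →
  [ (λ h → contradiction h (isolated u)) , id ]′ (cover v u (≢-sym u≢v))

PairCover⇒∣X∣≡1+k : 2 ≤ k → ∀ (X Y : Subset (2 + (k + k))) → PairCover k X Y → ∣ X ∣ ≡ suc k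
PairCover⇒∣X∣≡1+k {k} 2≤k X Y cover with <-cmp ∣ X ∣ (suc k)
... | tri< ∣X∣<1+k _ _ = ⊥-elim (PairCover⇒¬Isolated 2≤k X Y cover (∣X∣≤k⇒∃-Isolated (<⇒≤ 2≤k) X (≤-pred ∣X∣<1+k)))
... | tri≈ _ ∣X∣≡1+k _ = ∣X∣≡1+k
... | tri> _ _ 1+k<∣X∣ = ⊥-elim (PairCover⇒¬Isolated 2≤k X Y cover (1+k<∣X∣⇒∃-Isolated (<⇒≤ 2≤k) X 1+k<∣X∣))

toFin₂ : Bool → Fin 2
toFin₂ = Inverse.from 2↔Bool

toFin₂-injective : ∀ {a b} → toFin₂ a ≡ toFin₂ b → a ≡ b
toFin₂-injective {a} {b} e = begin
  a                               ≡⟨ Inverse.strictlyInverseˡ 2↔Bool a ⟨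
  Inverse.to 2↔Bool (toFin₂ a)    ≡⟨ cong (Inverse.to 2↔Bool) e ⟩
  Inverse.to 2↔Bool (toFin₂ b)    ≡⟨ Inverse.strictlyInverseˡ 2↔Bool b ⟩
  b                               ∎
  where open ≡-Reasoning

toFin₄ : Bool → Bool → Fin 4
toFin₄ a b = combine (toFin₂ a) (toFin₂ b)

toFin₄-injective : ∀ {a b c d} → toFin₄ a b ≡ toFin₄ c d → a ≡ c × b ≡ d
toFin₄-injective {a} {b} {c} {d} e =
    toFin₂-injective (combine-injectiveˡ (toFin₂ a) (toFin₂ b) (toFin₂ c) (toFin₂ d) e)
  , toFin₂-injective (combine-injectiveʳ (toFin₂ a) (toFin₂ b) (toFin₂ c) (toFin₂ d) e)

∃-twins : 4 < n → ∀ (X Y : Subset n) →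
          ∃₂ λ i j → i ≢ j × lookup X i ≡ lookup X j × lookup Y i ≡ lookup Y j
∃-twins 4<n X Y with pigeonhole 4<n (λ u → toFin₄ (lookup X u) (lookup Y u))
... | i , j , i<j , same = i , j , Fin.<⇒≢ i<j , toFin₄-injective same

¬PairCover : 2 ≤ k → ∀ (X Y : Subset (2 + (k + k))) → ¬ PairCover k X Y
¬PairCover {k} 2≤k X Y cover with ∃-twins (≤-trans (n≤1+n 5) (+-monoʳ-≤ 2 (+-mono-≤ 2≤k 2≤k))) X Y
... | i , j , i≢j , xᵢ≡xⱼ , yᵢ≡yⱼ =
  [ (λ h → Halves⇒lookup≢ X (PairCover⇒∣X∣≡1+k 2≤k X Y cover) h xᵢ≡xⱼ)
  , (λ h → Halves⇒lookup≢ Y (PairCover⇒∣X∣≡1+k 2≤k Y X (PairCover-swap X Y cover)) h yᵢ≡yⱼ)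
  ]′ (cover i j i≢j)

Secting⇒Halves : ∀ k {F′} → Secting D±1 (pairComplements (2 + (k + k))) F′ →
                 ∀ {i j} → i ≢ j → Any (λ X → Halves k X i j) F′
Secting⇒Halves k secting i≢j =
  Any.map (D±1[disc]⇒Halves i≢j _) (All.lookup secting (pairComplement∈pairComplements i≢j))

pairComplements-β≥3 : 2 ≤ k → βGe D±1 (pairComplements (2 + (k + k))) 3
pairComplements-β≥3 {k} 2≤k []              secting =
  contradiction (Secting⇒Halves k secting {zero} {suc zero} λ ()) λ ()
pairComplements-β≥3 {k} 2≤k (X ∷ [])        secting = ⊥-elim (¬PairCover 2≤k X X λ i j i≢j →
  inj₁ (singleton⁻ (Secting⇒Halves k secting i≢j)))
pairComplements-β≥3 {k} 2≤k (X ∷ Y ∷ [])    secting = ⊥-elim (¬PairCover 2≤k X Y λ i j i≢j →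
  Sum.map₂ singleton⁻ (Any.toSum (Secting⇒Halves k secting i≢j)))
pairComplements-β≥3     _   (_ ∷ _ ∷ _ ∷ _) _       = s≤s (s≤s (s≤s z≤n))

even>4⇒≡2+[k+k] : ∀ {n} → 2 ∣ n → 4 < n → ∃ λ k → 2 ≤ k × n ≡ 2 + (k + k)
even>4⇒≡2+[k+k] (divides zero refl) ()
even>4⇒≡2+[k+k] (divides (suc zero) refl) (s≤s (s≤s ()))
even>4⇒≡2+[k+k] (divides (suc (suc zero)) refl) (s≤s (s≤s (s≤s (s≤s ()))))
even>4⇒≡2+[k+k] (divides (suc k@(suc (suc _))) refl) _ =
  k , s≤s (s≤s z≤n) , cong (2 +_) (trans (*-comm k 2) (cong (k +_) (+-identityʳ k)))

proposition2 : (n : ℕ) → 2 ∣ n → 4 < n →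
    ((F : List (Subset n)) → Uniform (n ∸ 2) F → βLe D±1 F 3)
    × Σ (List (Subset n)) (λ F → Uniform (n ∸ 2) F × βGe D±1 F 3)
proposition2 n 2∣n 4<n with even>4⇒≡2+[k+k] 2∣n 4<n
... | k , 2≤k , refl =
  ThreeSets.β≤3 k , pairComplements (2 + (k + k)) , pairComplements-uniform , pairComplements-β≥3 2≤k
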